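{- Let $\Sigma=(\sigma_1,\dots,\sigma_{t+1})$ be any bad $t$-trajectory of an algorithm following the $\pi$-strategy, and let $w(\Sigma)=(S_0,\dots,S_t)$ be its witness sequence. Then $w(\Sigma)$ is plausible, $\pi(\sigma_i)=\pi(S_i^*)=(i)$ for all $1\le i\le t$, and for every $z\in[m]$, the number of occurrences of $z$ in the multiset $\bigcup_{i=0}^tS_i$ minus the number of occurrences of $z$ in the multiset $\{(1),\dots,(t)\}$ equals $\mathbf 1_{z\in S^*_{t+1}}$.
   Context: Setting: $\Omega$ finite, flaws $f_1,\dots,f_m\subseteq\Omega$, $\Omega^*=\bigcup_i f_i$, $U(\sigma)=\{j:\sigma\in f_j\}$. For $\sigma\in f_i$, $\rho_i(\sigma,\cdot)$ is a probability distribution on $\Omega$. The algorithm starts from a state drawn from a distribution $\theta$ and, while in a flawed state $\sigma$, addresses a flaw $i\in U(\sigma)$ by moving to $\tau\sim\rho_i(\sigma,\cdot)$. Fix a permutation $\pi$ of $[m]$; for nonempty $S\subseteq[m]$, $\pi(S)$ denotes the element of $S$ that comes first according to $\pi$, and $\pi(\sigma):=\pi(U(\sigma))$; the $\pi$-strategy addresses $\pi(\sigma)$ in state $\sigma$. $A-\pi(B)$ denotes $A\setminus\{\pi(B)\}$. A bad $t$-trajectory is a trajectory $(\sigma_1,\dots,\sigma_{t+1})$ of the algorithm all of whose states are flawed. For such a trajectory let $B_0=U(\sigma_1)$ and for $1\le i\le t$, $B_i=U(\sigma_{i+1})\setminus[U(\sigma_i)-\pi(\sigma_i)]$; for $0\le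 i\le t$ let $C_i=\{k\in B_i:\exists j\in[i+1,t]\ \text{with}\ k\notin U(\sigma_{j+1})\ \text{and}\ k\neq\pi(\sigma_\ell)\ \forall \ell\in[i+1,j]\}$. The witness sequence is $w(\Sigma)=(B_0\setminus C_0,\dots,B_t\setminus C_t)$. For an arbitrary sequence $S_0,\dots,S_t$ of subsets of $[m]$ define $S_1^*=S_0$ and for $1\le i\le t$, $S_{i+1}^*=[S_i^*-\pi(S_i^*)]\cup S_i$ if $S_i^*\neq\emptyset$ and $S_{i+1}^*=\emptyset$ otherwise. The sequence is plausible if $S_i^*\neq\emptyset$ for all $1\le i\le t$, in which case one writes $(i)=\pi(S_i^*)$.
   Formalization: The start distribution θ and the transition distributions $\rho_i(\sigma,\cdot)$ take rational values. -}

module Defs where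

open import Data.Nat using (ℕ; zero; suc; _+_; _∸_; _≤_; _<_)
open import Data.Bool using (Bool; true; false; _∧_; _∨_; not; if_then_else_)
open import Data.Fin using (Fin; _≟_)
open import Data.Fin.Subset using (Subset; ∁; _∩_; _∪_; _-_; ⊥; Nonempty)
open import Data.Fin.Permutation using (Permutation; _⟨$⟩ʳ_)
open import Data.Vec using (lookup; tabulate)
open import Data.List using (List; []; _∷_; map; upTo; foldr)
open import Data.Bool.ListAction using (any; all)
open import Data.List.Base using () renaming (allFin to allFinL)
open import Data.Maybe using (Maybe; just; nothing)
open import Data.Integer using (ℤ) renaming (+_ to ℤ+)
open import Data.Rational using (ℚ; 0ℚ; 1ℚ) renaming (_+_ to _+ℚ_; _≤_ to _≤ℚ_; _<_ to _<ℚ_)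
open import Data.Product using (_×_)
open import Relation.Nullary using (does)
open import Relation.Binary.PropositionalEquality using (_≡_)

-- State space Ω = Fin n.  Flaws f_1..f_m are f : Fin m → Subset n.
-- A permutation π of [m] is given as  ord : Permutation m m , read as the
-- list ord(0), ord(1), …, ord(m-1): flaw  ord ⟨$⟩ʳ p  is at position p.

U : ∀ {n m} → (Fin m → Subset n) → Fin n → Subset m
U f σ = tabulate (λ j → lookup (f j) σ)

-- π(S): the element of S that comes first according to π (nothing if S = ∅)
firstIn : ∀ {m} → Permutation m m → Subset m → List (Fin m) → Maybe (Fin m)
firstIn ord S [] = nothing
firstIn ord S (p ∷ ps) with lookup S (ord ⟨$⟩ʳ p)
... | true  = just (ord ⟨$⟩ʳ p)
... | false = firstIn ord S ps

πof : ∀ {m} → Permutation m m → Subset m → Maybe (Fin m)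
πof {m} ord S = firstIn ord S (allFinL m)

-- A − π(B)  (for B = ∅ nothing is removed; only used for nonempty B)
minusπ : ∀ {m} → Permutation m m → Subset m → Subset m → Subset m
minusπ ord A B with πof ord B
... | just k  = A - k
... | nothing = A

notπ : ∀ {m} → Permutation m m → Subset m → Fin m → Bool
notπ ord S k with πof ord S
... | just k' = not (does (k ≟ k'))
... | nothing = true

-- the list [a, a+1, …, b]  (empty if b < a)
range : ℕ → ℕ → List ℕ
range a b = map (a +_) (upTo (suc b ∸ a))

sumℚ : ∀ {n} → (Fin n → ℚ) → ℚ
sumℚ {n} p = foldr _+ℚ_ 0ℚ (map p (allFinL n))

IsDistribution : ∀ {n} → (Fin n → ℚ) → Set
IsDistribution p = (∀ x → 0ℚ ≤ℚ p x) × (sumℚ p ≡ 1ℚ)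

-- Trajectories are indexed σ_1, …, σ_{t+1} as a function σ : ℕ → Ω;
-- values outside [1, t+1] are irrelevant.

Flawed : ∀ {n m} → (Fin m → Subset n) → Fin n → Set
Flawed f σ = Nonempty (U f σ)

-- Bad t-trajectory of the algorithm following the π-strategy, started from θ,
-- with transition distributions ρ_i(σ,·) (ρ i σ τ).
BadTrajectory : ∀ {n m} → (Fin m → Subset n) → Permutation m m →
                (Fin n → ℚ) → (Fin m → Fin n → Fin n → ℚ) →
                ℕ → (ℕ → Fin n) → Set
BadTrajectory f ord θ ρ t σ =
  (0ℚ <ℚ θ (σ 1)) ×
  (∀ i → 1 ≤ i → i ≤ suc t → Flawed f (σ i)) ×
  (∀ i → 1 ≤ i → i ≤ t → ∀ k → πof ord (U f (σ i)) ≡ just k →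
       0ℚ <ℚ ρ k (σ i) (σ (suc i)))

module Witness {n m : ℕ} (f : Fin m → Subset n) (ord : Permutation m m)
               (t : ℕ) (σ : ℕ → Fin n) where

  Uσ : ℕ → Subset m
  Uσ i = U f (σ i)

  B : ℕ → Subset m
  B zero    = Uσ 1
  B (suc i) = Uσ (suc (suc i)) ∩ ∁ (minusπ ord (Uσ (suc i)) (Uσ (suc i)))

  -- k ∈ C_i  iff  k ∈ B_i and ∃ j ∈ [i+1,t], k ∉ U(σ_{j+1}) and
  --                            k ≠ π(σ_ℓ) for all ℓ ∈ [i+1, j]
  C : ℕ → Subset m
  C i = tabulate (λ k → lookup (B i) k ∧
          any (λ j → not (lookup (Uσ (suc j)) k) ∧
                     all (λ ℓ → notπ ord (Uσ ℓ) k) (range (suc i) j))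
              (range (suc i) t))

  w : ℕ → Subset m
  w i = B i ∩ ∁ (C i)

module Plausibility {m : ℕ} (ord : Permutation m m) (S : ℕ → Subset m) where

  -- S*_1 = S_0 ; S*_{i+1} = [S*_i − π(S*_i)] ∪ S_i if S*_i ≠ ∅, else ∅.
  -- (S* 0 is an unused dummy.)
  isEmpty : Subset m → Bool
  isEmpty A with πof ord A
  ... | just _  = false
  ... | nothing = true

  Sstar : ℕ → Subset m
  Sstar zero = ⊥
  Sstar (suc zero) = S 0
  Sstar (suc (suc i)) =
    if isEmpty (Sstar (suc i)) then ⊥
    else (minusπ ord (Sstar (suc i)) (Sstar (suc i)) ∪ S (suc i))

  Plausible : ℕ → Set
  Plausible t = ∀ i → 1 ≤ i → i ≤ t → Nonempty (Sstar i)

  paren : ℕ → Maybe (Fin m)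
  paren i = πof ord (Sstar i)

  occS : ℕ → Fin m → ℕ
  occS t z = foldr (λ i acc → if lookup (S i) z then suc acc else acc) 0 (range 0 t)

  occParen : ℕ → Fin m → ℕ
  occParen t z = foldr (λ i acc → if isJustEq (paren i) then suc acc else acc) 0 (range 1 t)
    where
    isJustEq : Maybe (Fin m) → Bool
    isJustEq (just k) = does (k ≟ z)
    isJustEq nothing  = false

  indicator : Bool → ℤ
  indicator true  = ℤ+ 1
  indicator false = ℤ+ 0

module Submission where

open import Defs
open import Data.Nat using (ℕ; suc; _≤_)
open import Data.Fin using (Fin)
open import Data.Fin.Subset using (Subset; _∈_)
open import Data.Fin.Permutation using (Permutation)
open import Data.Vec using (lookup)
open import Data.Integer using (ℤ; _-_) renaming (+_ to ℤ+)
open import Data.Rational using (ℚ)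
open import Data.Product using (_×_)
open import Relation.Binary.PropositionalEquality using (_≡_)

open import Data.Nat using (zero; _+_; _∸_; _<_; z≤n; s≤s)
open import Data.Nat.Properties
  using (≤-refl; ≤-trans; n≤1+n; m≤m+n; +-suc; +-assoc; +-comm; +-identityʳ;
         +-∸-assoc; m+[n∸m]≡n; m≤n⇒m∸n≡0; m+n∸m≡n)
open import Data.Integer using (_⊖_)
open import Data.Integer.Properties using ([+m]-[+n]≡m⊖n; ⊖-≥)
open import Data.Bool using (Bool; true; false; _∧_; _∨_; not; if_then_else_)
open import Data.Bool.Properties using (∧-identityʳ)
open import Data.Bool.ListAction using (any; all)
open import Data.Fin using (zero; suc; _≟_)
open import Data.Fin.Subset using (_∩_; _∪_; ∁; ⊥; _─_; Nonempty)
open import Data.Fin.Permutation using (_⟨$⟩ʳ_; _⟨$⟩ˡ_; inverseʳ)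
open import Data.Vec using (_∷_)
open import Data.Vec.Properties using (lookup-zipWith; lookup-map; lookup∘tabulate; []=⇒lookup; lookup⇒[]=)
open import Data.List using (List; []; _∷_; _++_; map; upTo; applyUpTo; foldr)
open import Data.List.Base using () renaming (allFin to allFinL)
open import Data.List.Properties using (map-++; map-∘; map-cong; map-upTo; upTo-∷ʳ; foldr-cong)
open import Data.List.Membership.Propositional using () renaming (_∈_ to _∈ₗ_)
open import Data.List.Membership.Propositional.Properties using (∈-map⁻; ∈-allFin)
open import Data.List.Relation.Unary.Any using (here; there)
open import Data.Maybe using (Maybe; just; nothing)
open import Data.Product using (Σ; _,_)
open import Function using (_∘_)
open import Relation.Nullary using (does; yes; no)
open import Relation.Nullary.Decidable using (dec-true; dec-false)
open import Relation.Binary.PropositionalEquality using (refl; sym; trans; cong; cong₂; module ≡-Reasoning)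

-- Say that flaw k "vanishes from step i on" if for some
-- j ∈ [i, t] it is absent from σ_{j+1} although it was not addressed at any
-- of the steps i, …, j; by definition C_i = B_i ∩ {k : k vanishes from step
-- i+1 on}.  The heart of the proof is the invariant
--     S*_{j+1} = U(σ_{j+1}) ∖ {k : k vanishes from step j+1 on}     (j ≤ t),
-- proved by induction on j: an element of S*_{j+2} is either an unaddressed
-- survivor of S*_{j+1} or a new flaw of B_{j+1} that does not vanish later.
-- The addressed flaw π(σ_{j+1}) never vanishes from step j+1 on, so it lies in
-- S*_{j+1} ⊆ U(σ_{j+1}); hence S*_{j+1} ≠ ∅ and π(S*_{j+1}) = π(σ_{j+1}).
-- For the occurrence count we prove, for an arbitrary sequence S, that if each
-- S_i is disjoint from S*_i − (i) then #z in S_0..S_T equals #z in (1)..(T)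
-- plus [z ∈ S*_{T+1}]: the step S*_{T+1} ↦ S*_{T+2} removes (T+1) and adds
-- S_{T+1}.  For the witness sequence this disjointness holds because
-- S_{i} ⊆ B_{i} avoids U(σ_i) − π(σ_i) ⊇ S*_i − (i).

ind : Bool → ℕ
ind b = if b then 1 else 0

-- Counting version of "(A − e) ∪ X with e ∈ A and X ∩ (A − e) = ∅":
-- [x ∈ (A − e) ∪ X] + [x = e] = [x ∈ A] + [x ∈ X].
ind-replace : ∀ s e x → (e ≡ true → s ≡ true) → (s ≡ true → e ≡ false → x ≡ false) →
              ind ((s ∧ not e) ∨ x) + ind e ≡ ind s + ind x
ind-replace false false x _ _ = +-identityʳ (ind x)
ind-replace false true x e⇒s _ with () ← e⇒s refl
ind-replace true false x _ disj rewrite disj refl refl = refl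
ind-replace true true false _ _ = refl
ind-replace true true true _ _ = refl

-- The pointwise form of the invariant step: with u, u′ membership in
-- U(σ_{j+1}), U(σ_{j+2}), e "is the addressed flaw" and d′ "vanishes from
-- step j+2 on", survivors of S*_{j+1} together with the retained part of
-- B_{j+1} are exactly the elements of U(σ_{j+2}) that do not vanish later.
survivors-or-new : ∀ u u′ e d′ →
  ((u ∧ not (not e ∧ (not u′ ∨ d′))) ∧ not e) ∨ ((u′ ∧ not (u ∧ not e)) ∧ not d′)
    ≡ u′ ∧ not d′
survivors-or-new false false e d′ = refl
survivors-or-new false true e d′ = refl
survivors-or-new true false false d′ = refl
survivors-or-new true false true d′ = refl
survivors-or-new true true false false = refl
survivors-or-new true true false true = refl
survivors-or-new true true true d′ = refl

∧-trueˡ : ∀ {a b} → a ∧ b ≡ true → a ≡ true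
∧-trueˡ {true} _ = refl

≟-sound : ∀ {m} {x y : Fin m} → does (x ≟ y) ≡ true → x ≡ y
≟-sound {x = x} {y} eq with x ≟ y
... | yes x≡y = x≡y
≟-sound () | no _

≟-sym : ∀ {m} (x y : Fin m) → does (x ≟ y) ≡ does (y ≟ x)
≟-sym x y with x ≟ y
... | yes refl = sym (dec-true (x ≟ x) refl)
... | no x≢y = sym (dec-false (y ≟ x) (x≢y ∘ sym))

lookup-∩ : ∀ {m} (p q : Subset m) k → lookup (p ∩ q) k ≡ lookup p k ∧ lookup q k
lookup-∩ p q k = lookup-zipWith _∧_ k p q

lookup-∪ : ∀ {m} (p q : Subset m) k → lookup (p ∪ q) k ≡ lookup p k ∨ lookup q k
lookup-∪ p q k = lookup-zipWith _∨_ k p q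

lookup-∩∁ : ∀ {m} (p q : Subset m) k → lookup (p ∩ ∁ q) k ≡ lookup p k ∧ not (lookup q k)
lookup-∩∁ p q k = trans (lookup-∩ p (∁ q) k) (cong (lookup p k ∧_) (lookup-map k not q))

lookup-─⊥ : ∀ {m} (p : Subset m) k → lookup (p ─ ⊥) k ≡ lookup p k
lookup-─⊥ (b ∷ p) zero = refl
lookup-─⊥ (b ∷ p) (suc k) = lookup-─⊥ p k

lookup-minus : ∀ {m} (p : Subset m) x k →
               lookup (p Data.Fin.Subset.- x) k ≡ lookup p k ∧ not (does (k ≟ x))
lookup-minus (false ∷ p) zero zero = refl
lookup-minus (true ∷ p) zero zero = refl
lookup-minus (b ∷ p) zero (suc k) = trans (lookup-─⊥ p k) (sym (∧-identityʳ _))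
lookup-minus (b ∷ p) (suc x) zero = sym (∧-identityʳ b)
lookup-minus (b ∷ p) (suc x) (suc k) = lookup-minus p x k

module FirstElement {m : ℕ} (ord : Permutation m m) where

  πof-mem : ∀ (A : Subset m) {p} → πof ord A ≡ just p → lookup A p ≡ true
  πof-mem A = go (allFinL m)
    where
    go : ∀ ps {p} → firstIn ord A ps ≡ just p → lookup A p ≡ true
    go [] ()
    go (q ∷ ps) eq with lookup A (ord ⟨$⟩ʳ q) in e
    go (q ∷ ps) refl | true = e
    go (q ∷ ps) eq | false = go ps eq

  πof-sub : ∀ (A B : Subset m) → (∀ k → lookup A k ≡ true → lookup B k ≡ true) →
            ∀ {p} → πof ord B ≡ just p → lookup A p ≡ true → πof ord A ≡ just p
  πof-sub A B A⊆B = go (allFinL m)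
    where
    go : ∀ ps {p} → firstIn ord B ps ≡ just p → lookup A p ≡ true → firstIn ord A ps ≡ just p
    go [] () _
    go (q ∷ ps) eq p∈A with lookup B (ord ⟨$⟩ʳ q) in eB | lookup A (ord ⟨$⟩ʳ q) in eA
    go (q ∷ ps) refl p∈A | true | true = refl
    go (q ∷ ps) refl p∈A | true | false with () ← trans (sym p∈A) eA
    go (q ∷ ps) eq p∈A | false | true with () ← trans (sym (A⊆B _ eA)) eB
    go (q ∷ ps) eq p∈A | false | false = go ps eq p∈A

  πof-nonempty : ∀ (A : Subset m) → Nonempty A → Σ (Fin m) λ p → πof ord A ≡ just p
  πof-nonempty A (x , x∈A) =
    go (allFinL m) (∈-allFin (ord ⟨$⟩ˡ x)) (trans (cong (lookup A) (inverseʳ ord)) ([]=⇒lookup x∈A))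
    where
    go : ∀ ps {q} → q ∈ₗ ps → lookup A (ord ⟨$⟩ʳ q) ≡ true → Σ (Fin m) λ p → firstIn ord A ps ≡ just p
    go (r ∷ ps) q∈ q∈A with lookup A (ord ⟨$⟩ʳ r) in e
    ... | true = ord ⟨$⟩ʳ r , refl
    go (r ∷ ps) (here refl) q∈A | false with () ← trans (sym q∈A) e
    go (r ∷ ps) (there q∈) q∈A | false = go ps q∈ q∈A

  notπ-just : ∀ (A : Subset m) {p} k → πof ord A ≡ just p → notπ ord A k ≡ not (does (k ≟ p))
  notπ-just A k eq rewrite eq = refl

  minusπ-just : ∀ (A B : Subset m) {p} → πof ord B ≡ just p → minusπ ord A B ≡ A Data.Fin.Subset.- p
  minusπ-just A B eq rewrite eq = refl

range-cons : ∀ a b → a ≤ b → range a b ≡ a ∷ range (suc a) b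
range-cons a b a≤b = begin
  map (a +_) (upTo (suc b ∸ a))               ≡⟨ cong (map (a +_) ∘ upTo) (+-∸-assoc 1 a≤b) ⟩
  a + 0 ∷ map (a +_) (applyUpTo suc (b ∸ a))   ≡⟨ cong₂ _∷_ (+-identityʳ a) shifted ⟩
  a ∷ range (suc a) b                          ∎
  where
  open ≡-Reasoning
  shifted : map (a +_) (applyUpTo suc (b ∸ a)) ≡ range (suc a) b
  shifted = begin
    map (a +_) (applyUpTo suc (b ∸ a))      ≡⟨ cong (map (a +_)) (map-upTo suc (b ∸ a)) ⟨
    map (a +_) (map suc (upTo (b ∸ a)))     ≡⟨ map-∘ (upTo (b ∸ a)) ⟨
    map (λ x → a + suc x) (upTo (b ∸ a))    ≡⟨ map-cong (+-suc a) (upTo (b ∸ a)) ⟩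
    range (suc a) b                         ∎

range-nil : ∀ a b → b < a → range a b ≡ []
range-nil a b b<a rewrite m≤n⇒m∸n≡0 b<a = refl

range-snoc : ∀ a b → a ≤ suc b → range a (suc b) ≡ range a b ++ (suc b ∷ [])
range-snoc a b a≤1+b = begin
  map (a +_) (upTo (suc (suc b) ∸ a))                ≡⟨ cong (map (a +_) ∘ upTo) (+-∸-assoc 1 a≤1+b) ⟩
  map (a +_) (upTo (suc (suc b ∸ a)))                ≡⟨ cong (map (a +_)) (upTo-∷ʳ (suc b ∸ a)) ⟨
  map (a +_) (upTo (suc b ∸ a) ++ (suc b ∸ a ∷ []))  ≡⟨ map-++ (a +_) (upTo (suc b ∸ a)) _ ⟩
  range a b ++ (a + (suc b ∸ a) ∷ [])                ≡⟨ cong (λ x → range a b ++ (x ∷ [])) (m+[n∸m]≡n a≤1+b) ⟩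
  range a b ++ (suc b ∷ [])                          ∎
  where open ≡-Reasoning

range-mem : ∀ a b {j} → j ∈ₗ range a b → a ≤ j
range-mem a b j∈ with ∈-map⁻ (a +_) j∈
... | x , _ , refl = m≤m+n a x

any-cong : ∀ {f g : ℕ → Bool} xs → (∀ j → j ∈ₗ xs → f j ≡ g j) → any f xs ≡ any g xs
any-cong [] _ = refl
any-cong (x ∷ xs) f≡g = cong₂ _∨_ (f≡g x (here refl)) (any-cong xs (λ j j∈ → f≡g j (there j∈)))

any-∧ˡ : ∀ (c : Bool) (g : ℕ → Bool) xs → any (λ j → c ∧ g j) xs ≡ c ∧ any g xs
any-∧ˡ false g [] = refl
any-∧ˡ true g [] = refl
any-∧ˡ false g (x ∷ xs) = any-∧ˡ false g xs
any-∧ˡ true g (x ∷ xs) = cong (g x ∨_) (any-∧ˡ true g xs)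

-- Number of elements of a list satisfying a Boolean predicate; occS and
-- occParen are both of this form.
count : (ℕ → Bool) → List ℕ → ℕ
count b = foldr (λ i acc → if b i then suc acc else acc) 0

count-++ : ∀ b xs ys → count b (xs ++ ys) ≡ count b xs + count b ys
count-++ b [] ys = refl
count-++ b (x ∷ xs) ys = trans (cong (λ n → if b x then suc n else n) (count-++ b xs ys)) (if-+ (b x))
  where
  if-+ : ∀ c → (if c then suc (count b xs + count b ys) else count b xs + count b ys)
              ≡ (if c then suc (count b xs) else count b xs) + count b ys
  if-+ false = refl
  if-+ true = refl

count-range-snoc : ∀ b a T → a ≤ suc T → count b (range a (suc T)) ≡ count b (range a T) + ind (b (suc T))
count-range-snoc b a T a≤1+T = trans (cong (count b) (range-snoc a T a≤1+T)) (count-++ b (range a T) _)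

module StarSequence {m : ℕ} (ord : Permutation m m) (S : ℕ → Subset m) where
  open Plausibility ord S
  open FirstElement ord

  isEmpty-just : ∀ (A : Subset m) {p} → πof ord A ≡ just p → isEmpty A ≡ false
  isEmpty-just A eq rewrite eq = refl

  Sstar-lookup : ∀ j {p} → πof ord (Sstar (suc j)) ≡ just p → ∀ k →
    lookup (Sstar (suc (suc j))) k ≡ (lookup (Sstar (suc j)) k ∧ not (does (k ≟ p))) ∨ lookup (S (suc j)) k
  Sstar-lookup j {p} πS k = begin
    lookup (Sstar (suc (suc j))) k
      ≡⟨ cong (λ b → lookup (if b then ⊥ else minusπ ord (Sstar (suc j)) (Sstar (suc j)) ∪ S (suc j)) k)
              (isEmpty-just (Sstar (suc j)) πS) ⟩
    lookup (minusπ ord (Sstar (suc j)) (Sstar (suc j)) ∪ S (suc j)) k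
      ≡⟨ lookup-∪ (minusπ ord (Sstar (suc j)) (Sstar (suc j))) (S (suc j)) k ⟩
    lookup (minusπ ord (Sstar (suc j)) (Sstar (suc j))) k ∨ lookup (S (suc j)) k
      ≡⟨ cong (λ A → lookup A k ∨ lookup (S (suc j)) k) (minusπ-just (Sstar (suc j)) (Sstar (suc j)) πS) ⟩
    lookup (Sstar (suc j) Data.Fin.Subset.- p) k ∨ lookup (S (suc j)) k
      ≡⟨ cong (_∨ lookup (S (suc j)) k) (lookup-minus (Sstar (suc j)) p k) ⟩
    (lookup (Sstar (suc j)) k ∧ not (does (k ≟ p))) ∨ lookup (S (suc j)) k ∎
    where open ≡-Reasoning

  picks : Fin m → Maybe (Fin m) → Bool
  picks z (just k) = does (k ≟ z)
  picks z nothing = false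

  -- occParen sums an indicator that is local to its definition in Defs; it is
  -- named here by reading it off that definition, and agrees with picks.
  parenIndicator : ℕ → Fin m → ℕ → Bool
  parenIndicator T z = summand {n = occParen T z} refl
    where
    summand : ∀ {b : ℕ → Bool} {n} → count b (range 1 T) ≡ n → ℕ → Bool
    summand {b} _ = b

  parenIndicator-picks : ∀ T z i → parenIndicator T z i ≡ picks z (paren i)
  parenIndicator-picks T z i with paren i
  ... | just _ = refl
  ... | nothing = refl

  occParen-count : ∀ T z → occParen T z ≡ count (λ i → picks z (paren i)) (range 1 T)
  occParen-count T z =
    foldr-cong (λ i acc → cong (λ c → if c then suc acc else acc) (parenIndicator-picks T z i)) refl (range 1 T)

  occParen-step : ∀ T z {p} → paren (suc T) ≡ just p → occParen (suc T) z ≡ occParen T z + ind (does (z ≟ p))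
  occParen-step T z {p} eq = begin
    occParen (suc T) z                                            ≡⟨ occParen-count (suc T) z ⟩
    count picked (range 1 (suc T))                                ≡⟨ count-range-snoc picked 1 T (s≤s z≤n) ⟩
    count picked (range 1 T) + ind (picks z (paren (suc T)))      ≡⟨ cong₂ _+_ (sym (occParen-count T z)) (cong (ind ∘ picks z) eq) ⟩
    occParen T z + ind (does (p ≟ z))                             ≡⟨ cong (λ b → occParen T z + ind b) (≟-sym p z) ⟩
    occParen T z + ind (does (z ≟ p))                             ∎
    where
    open ≡-Reasoning
    picked : ℕ → Bool
    picked i = picks z (paren i)

  FreshAt : ℕ → Fin m → Set
  FreshAt i p = ∀ z → lookup (Sstar i) z ≡ true → does (z ≟ p) ≡ false → lookup (S i) z ≡ false

  occurrence-balance : ∀ T → (∀ j → suc j ≤ T → Σ (Fin m) λ p → (paren (suc j) ≡ just p) × FreshAt (suc j) p) →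
                       ∀ z → occS T z ≡ occParen T z + ind (lookup (Sstar (suc T)) z)
  occurrence-balance zero _ z = refl
  occurrence-balance (suc T) disjoint z with disjoint T ≤-refl
  ... | p , πS , freshT = begin
    occS (suc T) z                         ≡⟨ count-range-snoc (λ i → lookup (S i) z) 0 T z≤n ⟩
    occS T z + ind x                       ≡⟨ cong (_+ ind x) (occurrence-balance T (λ j j<T → disjoint j (≤-trans j<T (n≤1+n T))) z) ⟩
    (occParen T z + ind s) + ind x         ≡⟨ +-assoc (occParen T z) (ind s) (ind x) ⟩
    occParen T z + (ind s + ind x)         ≡⟨ cong (occParen T z +_) replace ⟨
    occParen T z + (ind s′ + ind e)        ≡⟨ cong (occParen T z +_) (+-comm (ind s′) (ind e)) ⟩
    occParen T z + (ind e + ind s′)        ≡⟨ +-assoc (occParen T z) (ind e) (ind s′) ⟨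
    (occParen T z + ind e) + ind s′        ≡⟨ cong (_+ ind s′) (occParen-step T z πS) ⟨
    occParen (suc T) z + ind s′            ∎
    where
    open ≡-Reasoning
    s x e s′ : Bool
    s = lookup (Sstar (suc T)) z
    x = lookup (S (suc T)) z
    e = does (z ≟ p)
    s′ = lookup (Sstar (suc (suc T))) z
    e⇒s : e ≡ true → s ≡ true
    e⇒s z≟p with refl ← ≟-sound {x = z} {p} z≟p = πof-mem (Sstar (suc T)) πS
    replace : ind s′ + ind e ≡ ind s + ind x
    replace rewrite Sstar-lookup T πS z = ind-replace s e x e⇒s (freshT z)

  difference-indicator : ∀ a b → ℤ+ (a + ind b) - ℤ+ a ≡ indicator b
  difference-indicator a b = begin
    ℤ+ (a + ind b) - ℤ+ a   ≡⟨ [+m]-[+n]≡m⊖n (a + ind b) a ⟩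
    (a + ind b) ⊖ a         ≡⟨ ⊖-≥ (m≤m+n a (ind b)) ⟩
    ℤ+ (a + ind b ∸ a)      ≡⟨ cong ℤ+ (m+n∸m≡n a (ind b)) ⟩
    ℤ+ (ind b)              ≡⟨ as-indicator b ⟩
    indicator b ∎
    where
    open ≡-Reasoning
    as-indicator : ∀ b → ℤ+ (ind b) ≡ indicator b
    as-indicator false = refl
    as-indicator true = refl

module Trajectory {n m : ℕ} (f : Fin m → Subset n) (ord : Permutation m m)
                  (t : ℕ) (σ : ℕ → Fin n)
                  (flawed : ∀ i → 1 ≤ i → i ≤ suc t → Flawed f (σ i)) where
  open Witness f ord t σ
  open Plausibility ord w
  open StarSequence ord w
  open FirstElement ord

  goneAt : ℕ → Fin m → ℕ → Bool
  goneAt i k j = not (lookup (Uσ (suc j)) k) ∧ all (λ ℓ → notπ ord (Uσ ℓ) k) (range i j)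

  -- Flaw k vanishes (without being addressed) from step i on; C_i is
  -- B_i ∩ {k : vanishesFrom (i+1) k}.
  vanishesFrom : ℕ → Fin m → Bool
  vanishesFrom i k = any (goneAt i k) (range i t)

  goneAt-peel : ∀ i k j → i ≤ j → goneAt i k j ≡ notπ ord (Uσ i) k ∧ goneAt (suc i) k j
  goneAt-peel i k j i≤j
    rewrite range-cons i j i≤j
    with not (lookup (Uσ (suc j)) k) | notπ ord (Uσ i) k
  ... | false | false = refl
  ... | false | true = refl
  ... | true | false = refl
  ... | true | true = refl

  vanishesFrom-step : ∀ i k {p} → i ≤ t → πof ord (Uσ i) ≡ just p →
    vanishesFrom i k ≡ not (does (k ≟ p)) ∧ (not (lookup (Uσ (suc i)) k) ∨ vanishesFrom (suc i) k)
  vanishesFrom-step i k {p} i≤t πσᵢ = begin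
    any (goneAt i k) (range i t)
      ≡⟨ any-cong (range i t) (λ j j∈ → goneAt-peel i k j (range-mem i t j∈)) ⟩
    any (λ j → P ∧ goneAt (suc i) k j) (range i t)
      ≡⟨ any-∧ˡ P (goneAt (suc i) k) (range i t) ⟩
    P ∧ any (goneAt (suc i) k) (range i t)
      ≡⟨ cong (λ xs → P ∧ any (goneAt (suc i) k) xs) (range-cons i t i≤t) ⟩
    P ∧ (goneAt (suc i) k i ∨ vanishesFrom (suc i) k)
      ≡⟨ cong (λ b → P ∧ (b ∨ vanishesFrom (suc i) k)) goneNext ⟩
    P ∧ (not (lookup (Uσ (suc i)) k) ∨ vanishesFrom (suc i) k)
      ≡⟨ cong (λ b → b ∧ _) (notπ-just (Uσ i) k πσᵢ) ⟩
    not (does (k ≟ p)) ∧ (not (lookup (Uσ (suc i)) k) ∨ vanishesFrom (suc i) k) ∎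
    where
    open ≡-Reasoning
    P : Bool
    P = notπ ord (Uσ i) k
    goneNext : goneAt (suc i) k i ≡ not (lookup (Uσ (suc i)) k)
    goneNext rewrite range-nil (suc i) i ≤-refl = ∧-identityʳ _

  addressed-stays : ∀ i {p} → i ≤ t → πof ord (Uσ i) ≡ just p → vanishesFrom i p ≡ false
  addressed-stays i {p} i≤t πσᵢ
    rewrite vanishesFrom-step i p i≤t πσᵢ | dec-true (p ≟ p) refl = refl

  w-lookup : ∀ i k → lookup (w i) k ≡ lookup (B i) k ∧ not (vanishesFrom (suc i) k)
  w-lookup i k = begin
    lookup (B i ∩ ∁ (C i)) k                                ≡⟨ lookup-∩∁ (B i) (C i) k ⟩
    lookup (B i) k ∧ not (lookup (C i) k)                    ≡⟨ cong (λ c → lookup (B i) k ∧ not c) (lookup∘tabulate _ k) ⟩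
    lookup (B i) k ∧ not (lookup (B i) k ∧ vanishesFrom (suc i) k) ≡⟨ absorb (lookup (B i) k) ⟩
    lookup (B i) k ∧ not (vanishesFrom (suc i) k)            ∎
    where
    open ≡-Reasoning
    absorb : ∀ b → b ∧ not (b ∧ vanishesFrom (suc i) k) ≡ b ∧ not (vanishesFrom (suc i) k)
    absorb false = refl
    absorb true = refl

  B-lookup : ∀ j k {p} → πof ord (Uσ (suc j)) ≡ just p →
    lookup (B (suc j)) k ≡ lookup (Uσ (suc (suc j))) k ∧ not (lookup (Uσ (suc j)) k ∧ not (does (k ≟ p)))
  B-lookup j k {p} πσ = begin
    lookup (Uσ (suc (suc j)) ∩ ∁ (minusπ ord (Uσ (suc j)) (Uσ (suc j)))) k
      ≡⟨ lookup-∩∁ (Uσ (suc (suc j))) _ k ⟩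
    lookup (Uσ (suc (suc j))) k ∧ not (lookup (minusπ ord (Uσ (suc j)) (Uσ (suc j))) k)
      ≡⟨ cong (λ A → lookup (Uσ (suc (suc j))) k ∧ not (lookup A k)) (minusπ-just (Uσ (suc j)) (Uσ (suc j)) πσ) ⟩
    lookup (Uσ (suc (suc j))) k ∧ not (lookup (Uσ (suc j) Data.Fin.Subset.- p) k)
      ≡⟨ cong (λ b → lookup (Uσ (suc (suc j))) k ∧ not b) (lookup-minus (Uσ (suc j)) p k) ⟩
    lookup (Uσ (suc (suc j))) k ∧ not (lookup (Uσ (suc j)) k ∧ not (does (k ≟ p))) ∎
    where open ≡-Reasoning

  w-disjoint : ∀ j k {p} → πof ord (Uσ (suc j)) ≡ just p →
    lookup (Uσ (suc j)) k ≡ true → does (k ≟ p) ≡ false → lookup (w (suc j)) k ≡ false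
  w-disjoint j k πσ k∈U k≢p
    rewrite w-lookup (suc j) k | B-lookup j k πσ | k∈U | k≢p
    with lookup (Uσ (suc (suc j))) k
  ... | false = refl
  ... | true = refl

  addressed : ∀ i → 1 ≤ i → i ≤ suc t → Σ (Fin m) λ p → πof ord (Uσ i) ≡ just p
  addressed i 1≤i i≤1+t = πof-nonempty (Uσ i) (flawed i 1≤i i≤1+t)

  Invariant : ℕ → Set
  Invariant j = ∀ k → lookup (Sstar (suc j)) k ≡ lookup (Uσ (suc j)) k ∧ not (vanishesFrom (suc j) k)

  Sstar⊆U : ∀ j → Invariant j → ∀ k → lookup (Sstar (suc j)) k ≡ true → lookup (Uσ (suc j)) k ≡ true
  Sstar⊆U j inv k k∈S = ∧-trueˡ (trans (sym (inv k)) k∈S)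

  same-first : ∀ j {p} → suc j ≤ t → Invariant j →
               πof ord (Uσ (suc j)) ≡ just p → πof ord (Sstar (suc j)) ≡ just p
  same-first j {p} j<t inv πσ = πof-sub (Sstar (suc j)) (Uσ (suc j)) (Sstar⊆U j inv) πσ p∈S
    where
    p∈S : lookup (Sstar (suc j)) p ≡ true
    p∈S = trans (inv p) (cong₂ (λ u d → u ∧ not d) (πof-mem (Uσ (suc j)) πσ) (addressed-stays (suc j) j<t πσ))

  invariant : ∀ j → j ≤ t → Invariant j
  invariant zero _ k = w-lookup 0 k
  invariant (suc j) j<t k with addressed (suc j) (s≤s z≤n) (≤-trans j<t (n≤1+n t))
  ... | p , πσ = begin
    lookup (Sstar (suc (suc j))) k
      ≡⟨ Sstar-lookup j (same-first j j<t inv πσ) k ⟩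
    (lookup (Sstar (suc j)) k ∧ not e) ∨ lookup (w (suc j)) k
      ≡⟨ cong₂ (λ s x → (s ∧ not e) ∨ x) (inv k) (w-lookup (suc j) k) ⟩
    ((u ∧ not (vanishesFrom (suc j) k)) ∧ not e) ∨ (lookup (B (suc j)) k ∧ not d′)
      ≡⟨ cong₂ (λ d b → ((u ∧ not d) ∧ not e) ∨ (b ∧ not d′)) (vanishesFrom-step (suc j) k j<t πσ) (B-lookup j k πσ) ⟩
    ((u ∧ not (not e ∧ (not u′ ∨ d′))) ∧ not e) ∨ ((u′ ∧ not (u ∧ not e)) ∧ not d′)
      ≡⟨ survivors-or-new u u′ e d′ ⟩
    u′ ∧ not d′ ∎
    where
    open ≡-Reasoning
    inv : Invariant j
    inv = invariant j (≤-trans (n≤1+n j) j<t)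
    u u′ e d′ : Bool
    u = lookup (Uσ (suc j)) k
    u′ = lookup (Uσ (suc (suc j))) k
    e = does (k ≟ p)
    d′ = vanishesFrom (suc (suc j)) k

  first-agrees : ∀ j → suc j ≤ t →
    Σ (Fin m) λ p → (πof ord (Uσ (suc j)) ≡ just p) × (πof ord (Sstar (suc j)) ≡ just p)
  first-agrees j j<t with addressed (suc j) (s≤s z≤n) (≤-trans j<t (n≤1+n t))
  ... | p , πσ = p , πσ , same-first j j<t (invariant j (≤-trans (n≤1+n j) j<t)) πσ

  fresh : ∀ j → suc j ≤ t → Σ (Fin m) λ p → (paren (suc j) ≡ just p) × FreshAt (suc j) p
  fresh j j<t with first-agrees j j<t
  ... | p , πσ , πS = p , πS , λ z z∈S* → w-disjoint j z πσ (Sstar⊆U j (invariant j (≤-trans (n≤1+n j) j<t)) z z∈S*)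

lemma3p1 : {n m : ℕ} (f : Fin m → Subset n) (ord : Permutation m m)
           (θ : Fin n → ℚ) (ρ : Fin m → Fin n → Fin n → ℚ) →
           IsDistribution θ →
           (∀ i σ → σ ∈ f i → IsDistribution (ρ i σ)) →
           (t : ℕ) (σ : ℕ → Fin n) →
           BadTrajectory f ord θ ρ t σ →
           let S = Witness.w f ord t σ
               open Plausibility ord S
           in Plausible t
              × (∀ i → 1 ≤ i → i ≤ t → πof ord (U f (σ i)) ≡ paren i)
              × (∀ z → ℤ+ (occS t z) - ℤ+ (occParen t z)
                        ≡ indicator (lookup (Sstar (suc t)) z))
lemma3p1 f ord _ _ _ _ t σ (_ , flawed , _) = plausible , same-π , occurrences
  where
  open Trajectory f ord t σ flawed
  open Witness f ord t σ
  open Plausibility ord w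
  open StarSequence ord w using (occurrence-balance; difference-indicator)
  open FirstElement ord using (πof-mem)

  plausible : Plausible t
  plausible (suc j) _ j<t with first-agrees j j<t
  ... | p , _ , πS = p , lookup⇒[]= p (Sstar (suc j)) (πof-mem (Sstar (suc j)) πS)

  same-π : ∀ i → 1 ≤ i → i ≤ t → πof ord (U f (σ i)) ≡ paren i
  same-π (suc j) _ j<t with first-agrees j j<t
  ... | _ , πσ , πS = trans πσ (sym πS)

  occurrences : ∀ z → ℤ+ (occS t z) - ℤ+ (occParen t z) ≡ indicator (lookup (Sstar (suc t)) z)
  occurrences z rewrite occurrence-balance t fresh z =
    difference-indicator (occParen t z) (lookup (Sstar (suc t)) z)
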